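{- Let $p,q$ be positive integers with $p\ge q$. For every tree $T$ of order $n$ (with $n\ge 2$), we have $$n\le a(p,q;T)\le n+q\left\lfloor \frac{n-2}{p}\right\rfloor .$$
   Context: For integers $p\ge q\ge 1$ and a finite graph $G$ with no isolated vertices, the $(p,q)$-achievement game of $G$ on the complete graph $K_N$ is played by two players, Alice and Bob, on the edges of $K_N$, all initially uncolored. In each round, Alice first chooses $p$ uncolored edges and colors them blue, then Bob chooses $q$ uncolored edges and colors them red. The player who first completes a copy of $G$ (a subgraph isomorphic to $G$) all of whose edges are in his or her own color wins; if neither does, the game is a draw. The $(p,q)$-achievement number $a(p,q;G)$ is the smallest $N$ for which Alice has a winning strategy in this game on $K_N$. -}

module Defs where

open import Data.Nat using (ℕ; zero; suc; _+_; _*_; _∸_; _≤_; _<_; _<ᵇ_; NonZero; >-nonZero)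
open import Data.Nat.DivMod using (_/_)
open import Data.Bool using (Bool; true; false; if_then_else_)
open import Data.Fin using (Fin; toℕ)
open import Data.Fin.Properties using () renaming (_≟_ to _≟ᶠ_)
open import Data.Product using (Σ; ∃; _×_; _,_)
open import Data.Product.Properties using (≡-dec)
open import Data.Sum using (_⊎_)
open import Data.Unit using (⊤)
open import Data.List using (List; []; _∷_; length; foldl)
open import Data.List.Relation.Unary.All using (All)
open import Data.List.Relation.Unary.Unique.Propositional using (Unique)
open import Relation.Binary.PropositionalEquality using (_≡_)
open import Relation.Binary.Definitions using (DecidableEquality)
open import Relation.Nullary using (¬_; does)
open import Function.Definitions using (Injective)

record Graph (n : ℕ) : Set where
  field
    adj   : Fin n → Fin n → Bool
    sym   : ∀ u v → adj u v ≡ adj v u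
    irref : ∀ u → adj u u ≡ false
open Graph public

data Walk {n : ℕ} (G : Graph n) : Fin n → Fin n → Set where
  here : ∀ {u} → Walk G u u
  step : ∀ {u w v} → adj G u w ≡ true → Walk G w v → Walk G u v

Connected : ∀ {n} → Graph n → Set
Connected {n} G = ∀ (u v : Fin n) → Walk G u v

IsPath : ∀ {n} → Graph n → List (Fin n) → Set
IsPath G []            = ⊤
IsPath G (x ∷ [])      = ⊤
IsPath G (x ∷ y ∷ rest) = (adj G x y ≡ true) × IsPath G (y ∷ rest)

lastOf : ∀ {A : Set} → A → List A → A
lastOf x xs = foldl (λ _ y → y) x xs

HasCycle : ∀ {n} → Graph n → Set
HasCycle {n} G = Σ (Fin n) λ x → Σ (List (Fin n)) λ rest →
  Unique (x ∷ rest) × (2 ≤ length rest) × IsPath G (x ∷ rest)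
  × (adj G (lastOf x rest) x ≡ true)

IsTree : ∀ {n} → Graph n → Set
IsTree G = Connected G × ¬ HasCycle G

data Colour : Set where
  uncol blue red : Colour

-- an edge {i,j} of K_N is represented by the ordered pair (i , j) with i < j
Edge : ℕ → Set
Edge N = Fin N × Fin N

IsEdge : ∀ {N} → Edge N → Set
IsEdge (i , j) = toℕ i < toℕ j

norm : ∀ {N} → Fin N → Fin N → Edge N
norm i j = if toℕ i <ᵇ toℕ j then (i , j) else (j , i)

-- a position: the colour of every edge (only entries with i < j matter)
State : ℕ → Set
State N = Edge N → Colour

initial : ∀ N → State N
initial N _ = uncol

_≟ₑ_ : ∀ {N} → DecidableEquality (Edge N)
_≟ₑ_ = ≡-dec _≟ᶠ_ _≟ᶠ_

open import Data.List.Membership.DecPropositional using (_∈?_)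
open import Data.List.Membership.Propositional using (_∈_)

paint : ∀ {N} → Colour → List (Edge N) → State N → State N
paint c m s e = if does (_∈?_ _≟ₑ_ e m) then c else s e

ValidMove : ∀ {N} → ℕ → State N → List (Edge N) → Set
ValidMove {N} k s m =
  Unique m × All (λ e → IsEdge e × s e ≡ uncol) m ×
  (length m ≡ k ⊎
   (length m < k × (∀ (e : Edge N) → IsEdge e → s e ≡ uncol → e ∈ m)))

SomeUncoloured : ∀ {N} → State N → Set
SomeUncoloured {N} s = Σ (Edge N) λ e → IsEdge e × s e ≡ uncol

HasCopy : ∀ {k N} → Graph k → Colour → State N → Set
HasCopy {k} {N} G c s = Σ (Fin k → Fin N) λ f → Injective _≡_ _≡_ f ×
  (∀ a b → adj G a b ≡ true → s (norm (f a) (f b)) ≡ c)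

-- Alice (to move, nobody has won yet) has a winning strategy from s
data AliceWins {k : ℕ} (G : Graph k) (p q N : ℕ) : State N → Set where
  move : ∀ {s} → SomeUncoloured s →
    (m : List (Edge N)) → ValidMove p s m →
    (HasCopy G blue (paint blue m s)
     ⊎ (∀ (m' : List (Edge N)) → ValidMove q (paint blue m s) m' →
          (¬ HasCopy G red (paint red m' (paint blue m s)))
          × AliceWins G p q N (paint red m' (paint blue m s)))) →
    AliceWins G p q N s

AliceWinsOn : ∀ {k} → ℕ → ℕ → Graph k → ℕ → Set
AliceWinsOn p q G N = AliceWins G p q N (initial N)

IsAchievementNumber : ∀ {k} → ℕ → ℕ → Graph k → ℕ → Set
IsAchievementNumber p q G a =
  AliceWinsOn p q G a × (∀ N → N < a → ¬ AliceWinsOn p q G N)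

-- A copy of T needs n distinct vertices, which gives the lower bound. For the upper bound, grow T
-- from a root as a sequence of steps (u , v), each attaching a new vertex v to its only earlier
-- neighbour u. On K_N with N = n + q ⌊(n − 2) / p⌋ Alice extends an embedding φ of T by p vertices
-- per round, sending v to a vertex w outside the image whose edge to φ u is still uncoloured. Her
-- edges stay inside the image and after r rounds Bob has coloured at most q r edges, so while some
-- vertex is missing (image of size 1 + r p ≤ n − 1) such a w exists. Bob cannot finish first: a red
-- tree needs n − 1 edges, but before Alice's last round he holds at most q r ≤ p r < n − 1. Since the
-- game on a fixed K_N is finite, Alice's winning is decidable, so a least such N exists.

module Submission where

open import Defs renaming (sym to adj-sym)
open import Data.Nat
  using (ℕ; NonZero; zero; suc; _+_; _*_; _∸_; _≤_; _<_; _/_; >-nonZero; z≤n; s≤s; _<ᵇ_; _<?_; _≤?_; _≟_)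
open import Data.Nat.Properties
open import Data.Nat.DivMod using (m*n/n≡m; /-monoˡ-≤)
open import Data.Product using (Σ; _×_; _,_; proj₁; proj₂)
open import Data.Product.Properties using (,-injectiveˡ; ,-injectiveʳ)
open import Data.Sum using (_⊎_; inj₁; inj₂)
open import Data.Empty using (⊥-elim)
open import Data.Unit using (tt)
open import Data.Bool using (true; false; T)
import Data.Bool.Properties as Bool
open import Data.Fin using (Fin; toℕ) renaming (zero to fzero; suc to fsuc)
open import Data.Fin.Properties using (injective⇒≤; any?; all?; toℕ-injective) renaming (_≟_ to _≟ᶠ_)
open import Data.Vec.Functional using (updateAt) renaming (_∷_ to _∷ᶠ_)
open import Data.Vec.Functional.Properties using (updateAt-updates; updateAt-minimal)
open import Data.List using (List; []; _∷_; length; _++_; map; lookup; allFin)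
open import Data.List.Properties using (length-tabulate; length-map; length-++; map-cong-local)
open import Data.List.Relation.Unary.All using (All; []; _∷_)
import Data.List.Relation.Unary.All as All
import Data.List.Relation.Unary.All.Properties as All
open import Data.List.Relation.Unary.Any using (here; there; index)
open import Data.List.Relation.Unary.Any.Properties using (lookup-index)
open import Data.List.Relation.Unary.AllPairs using ([]; _∷_; allPairs?)
open import Data.List.Relation.Unary.Unique.Propositional using (Unique)
import Data.List.Relation.Unary.Unique.Propositional.Properties as Unique
open import Data.List.Relation.Binary.Subset.Propositional using (_⊆_)
open import Data.List.Membership.Propositional using (_∈_; _∉_)
open import Data.List.Membership.Propositional.Properties
  using (∈-lookup; ∈-allFin; ∈-map⁺; ∈-map⁻; ∈-++⁺ˡ; ∈-++⁺ʳ)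
open import Data.List.Membership.DecPropositional using (_∈?_)
open import Relation.Binary.PropositionalEquality
  using (_≡_; _≢_; refl; sym; trans; cong; cong₂; subst; module ≡-Reasoning)
open import Relation.Nullary using (¬_; Dec; yes; no)
open import Relation.Nullary.Decidable using (map′; _×-dec_; _⊎-dec_; _→-dec_; ¬?)
open import Function.Definitions using (Injective)
open import Function using (case_of_; const)

m*n≤o⇒m≤o/n : ∀ {m o} n .{{_ : NonZero n}} → m * n ≤ o → m ≤ o / n
m*n≤o⇒m≤o/n {m} n mn≤o = ≤-trans (≤-reflexive (sym (m*n/n≡m m n))) (/-monoˡ-≤ n mn≤o)

Unique⇒lookup-injective : ∀ {A : Set} {xs : List A} → Unique xs →
  ∀ i j → lookup xs i ≡ lookup xs j → i ≡ j
Unique⇒lookup-injective (_ ∷ _)  fzero    fzero    _ = refl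
Unique⇒lookup-injective (x∉ ∷ _) fzero    (fsuc j) e = ⊥-elim (All.lookup x∉ (∈-lookup j) e)
Unique⇒lookup-injective (x∉ ∷ _) (fsuc i) fzero    e = ⊥-elim (All.lookup x∉ (∈-lookup i) (sym e))
Unique⇒lookup-injective (_ ∷ u)  (fsuc i) (fsuc j) e = cong fsuc (Unique⇒lookup-injective u i j e)

Unique∧⊆⇒length≤ : ∀ {A : Set} {xs ys : List A} → Unique xs → xs ⊆ ys → length xs ≤ length ys
Unique∧⊆⇒length≤ {xs = xs} {ys} u xs⊆ys = injective⇒≤ {f = position} position-injective
  where
  position : Fin (length xs) → Fin (length ys)
  position i = index (xs⊆ys (∈-lookup i))
  position-injective : Injective _≡_ _≡_ position
  position-injective {i} {j} e = Unique⇒lookup-injective u i j (begin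
    lookup xs i                  ≡⟨ lookup-index (xs⊆ys (∈-lookup i)) ⟩
    lookup ys (position i)       ≡⟨ cong (lookup ys) e ⟩
    lookup ys (position j)       ≡⟨ lookup-index (xs⊆ys (∈-lookup j)) ⟨
    lookup xs j                  ∎)
    where open ≡-Reasoning

∉⇒Unique-∷ : ∀ {A : Set} {x : A} {xs} → x ∉ xs → Unique xs → Unique (x ∷ xs)
∉⇒Unique-∷ x∉xs u = All.¬Any⇒All¬ _ x∉xs ∷ u

module _ {N : ℕ} where

  length-allFin : length (allFin N) ≡ N
  length-allFin = length-tabulate {n = N} (λ x → x)

  covering⇒N≤length : (L : List (Fin N)) → (∀ w → w ∈ L) → N ≤ length L
  covering⇒N≤length L covers = subst (_≤ length L) length-allFin
    (Unique∧⊆⇒length≤ (Unique.allFin⁺ N) (λ {x} _ → covers x))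

  Unique⇒length≤N : (L : List (Fin N)) → Unique L → length L ≤ N
  Unique⇒length≤N L u = subst (length L ≤_) length-allFin (Unique∧⊆⇒length≤ u (λ {x} _ → ∈-allFin x))

  ∉∧Unique⇒length<N : ∀ {L : List (Fin N)} {v} → v ∉ L → Unique L → length L < N
  ∉∧Unique⇒length<N {L} {v} v∉L u = Unique⇒length≤N (v ∷ L) (∉⇒Unique-∷ v∉L u)

pair-injective : ∀ {A B : Set} {a c : A} {b d : B} → (a , b) ≡ (c , d) → a ≡ c × b ≡ d
pair-injective e = ,-injectiveˡ e , ,-injectiveʳ e

module _ {N : ℕ} where

  norm-cases : (x y : Fin N) →
    (norm x y ≡ (x , y) × toℕ x < toℕ y) ⊎ (norm x y ≡ (y , x) × ¬ toℕ x < toℕ y)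
  norm-cases x y with toℕ x <ᵇ toℕ y in eq
  ... | true  = inj₁ (refl , <ᵇ⇒< (toℕ x) (toℕ y) (subst T (sym eq) tt))
  ... | false = inj₂ (refl , λ lt → subst T eq (<⇒<ᵇ lt))

  norm-endpoints : (x y : Fin N) → norm x y ≡ (x , y) ⊎ norm x y ≡ (y , x)
  norm-endpoints x y with norm-cases x y
  ... | inj₁ (e , _) = inj₁ e
  ... | inj₂ (e , _) = inj₂ e

  norm-IsEdge : (x y : Fin N) → x ≢ y → IsEdge (norm x y)
  norm-IsEdge x y x≢y with norm-cases x y
  ... | inj₁ (e , lt)  rewrite e = lt
  ... | inj₂ (e , ¬lt) rewrite e = ≤∧≢⇒< (≮⇒≥ ¬lt) (λ eq → x≢y (toℕ-injective (sym eq)))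

  norm-comm : (x y : Fin N) → x ≢ y → norm x y ≡ norm y x
  norm-comm x y x≢y with norm-cases x y | norm-cases y x
  ... | inj₁ (_ , lt) | inj₁ (_ , lt′) = ⊥-elim (<-asym lt lt′)
  ... | inj₁ (e , _)  | inj₂ (e′ , _) = trans e (sym e′)
  ... | inj₂ (e , _)  | inj₁ (e′ , _) = trans e (sym e′)
  ... | inj₂ (_ , ¬lt) | inj₂ (_ , ¬lt′) =
    ⊥-elim (x≢y (toℕ-injective (≤-antisym (≮⇒≥ ¬lt′) (≮⇒≥ ¬lt))))

  norm-injective : (x y x′ y′ : Fin N) → norm x y ≡ norm x′ y′ →
    (x ≡ x′ × y ≡ y′) ⊎ (x ≡ y′ × y ≡ x′)
  norm-injective x y x′ y′ e with norm-endpoints x y | norm-endpoints x′ y′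
  ... | inj₁ e₁ | inj₁ e₂ = inj₁ (pair-injective (trans (sym e₁) (trans e e₂)))
  ... | inj₁ e₁ | inj₂ e₂ = inj₂ (pair-injective (trans (sym e₁) (trans e e₂)))
  ... | inj₂ e₁ | inj₁ e₂ = let (a , b) = pair-injective (trans (sym e₁) (trans e e₂)) in inj₂ (b , a)
  ... | inj₂ e₁ | inj₂ e₂ = let (a , b) = pair-injective (trans (sym e₁) (trans e e₂)) in inj₁ (b , a)

  Within : List (Fin N) → Edge N → Set
  Within L e = proj₁ e ∈ L × proj₂ e ∈ L

  Within-∷ : ∀ {L e} x → Within L e → Within (x ∷ L) e
  Within-∷ x (a∈L , b∈L) = there a∈L , there b∈L

  Within-norm⁺ : ∀ {L} (x w : Fin N) → x ∈ L → w ∈ L → Within L (norm x w)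
  Within-norm⁺ x w x∈L w∈L with norm-endpoints x w
  ... | inj₁ e rewrite e = x∈L , w∈L
  ... | inj₂ e rewrite e = w∈L , x∈L

  Within-norm⁻ : ∀ {L} (x w : Fin N) → Within L (norm x w) → w ∈ L
  Within-norm⁻ x w ends with norm-endpoints x w
  ... | inj₁ e rewrite e = proj₂ ends
  ... | inj₂ e rewrite e = proj₁ ends

  opposite : Fin N → Edge N → Fin N
  opposite x (a , b) with a ≟ᶠ x
  ... | yes _ = b
  ... | no _  = a

  opposite-norm : (x w : Fin N) → opposite x (norm x w) ≡ w
  opposite-norm x w with norm-endpoints x w
  ... | inj₁ e rewrite e with x ≟ᶠ x
  ...   | yes _ = refl
  ...   | no x≢x = ⊥-elim (x≢x refl)
  opposite-norm x w | inj₂ e rewrite e with w ≟ᶠ x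
  ...   | yes w≡x = sym w≡x
  ...   | no _    = refl

module _ {N : ℕ} {c : Colour} {m : List (Edge N)} {s : State N} {e : Edge N} where

  paint-∈ : e ∈ m → paint c m s e ≡ c
  paint-∈ e∈m with _∈?_ _≟ₑ_ e m
  ... | yes _   = refl
  ... | no e∉m = ⊥-elim (e∉m e∈m)

  paint-∉ : e ∉ m → paint c m s e ≡ s e
  paint-∉ e∉m with _∈?_ _≟ₑ_ e m
  ... | yes e∈m = ⊥-elim (e∉m e∈m)
  ... | no _    = refl

  paint-idem : s e ≡ c → paint c m s e ≡ c
  paint-idem se≡c with _∈?_ _≟ₑ_ e m
  ... | yes _ = refl
  ... | no _  = se≡c

  paint-coloured : All (λ e → IsEdge e × s e ≡ uncol) m → s e ≢ uncol → paint c m s e ≡ s e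
  paint-coloured m-uncol se≢uncol = paint-∉ λ e∈m → se≢uncol (proj₂ (All.lookup m-uncol e∈m))

-- The game on a fixed K_N

_≟ᶜ_ : (a b : Colour) → Dec (a ≡ b)
uncol ≟ᶜ uncol = yes refl
uncol ≟ᶜ blue  = no λ ()
uncol ≟ᶜ red   = no λ ()
blue  ≟ᶜ uncol = no λ ()
blue  ≟ᶜ blue  = yes refl
blue  ≟ᶜ red   = no λ ()
red   ≟ᶜ uncol = no λ ()
red   ≟ᶜ blue  = no λ ()
red   ≟ᶜ red   = yes refl

module _ {N : ℕ} where

  ∃-Edge? : {P : Edge N → Set} → (∀ e → Dec (P e)) → Dec (Σ (Edge N) P)
  ∃-Edge? P? = map′ (λ (i , j , p) → (i , j) , p) (λ ((i , j) , p) → i , j , p)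
                    (any? λ i → any? λ j → P? (i , j))

  ∀-Edge? : {P : Edge N → Set} → (∀ e → Dec (P e)) → Dec (∀ e → P e)
  ∀-Edge? P? = map′ (λ h (i , j) → h i j) (λ h i j → h (i , j))
                    (all? λ i → all? λ j → P? (i , j))

  ∃-List≤? : (k : ℕ) {P : List (Edge N) → Set} → (∀ m → Dec (P m)) →
    Dec (Σ (List (Edge N)) λ m → length m ≤ k × P m)
  ∃-List≤? zero P? with P? []
  ... | yes p = yes ([] , z≤n , p)
  ... | no ¬p = no λ { ([] , _ , p) → ¬p p ; (_ ∷ _ , () , _) }
  ∃-List≤? (suc k) {P} P?
    with P? [] | ∃-Edge? (λ e → ∃-List≤? k {λ m → P (e ∷ m)} (λ m → P? (e ∷ m)))
  ... | yes p | _                     = yes ([] , z≤n , p)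
  ... | no ¬p | yes (e , m , m≤k , p) = yes (e ∷ m , s≤s m≤k , p)
  ... | no ¬p | no ¬q = no λ { ([] , _ , p) → ¬p p ; (e ∷ m , s≤s m≤k , p) → ¬q (e , m , m≤k , p) }

  ∀-List≤? : (k : ℕ) {P : List (Edge N) → Set} → (∀ m → Dec (P m)) →
    Dec (∀ m → length m ≤ k → P m)
  ∀-List≤? zero P? with P? []
  ... | yes p = yes λ { [] _ → p ; (_ ∷ _) () }
  ... | no ¬p = no λ h → ¬p (h [] z≤n)
  ∀-List≤? (suc k) {P} P?
    with P? [] | ∀-Edge? (λ e → ∀-List≤? k {λ m → P (e ∷ m)} (λ m → P? (e ∷ m)))
  ... | no ¬p | _     = no λ h → ¬p (h [] z≤n)
  ... | yes p | no ¬q = no λ h → ¬q λ e m m≤k → h (e ∷ m) (s≤s m≤k)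
  ... | yes p | yes q = yes λ { [] _ → p ; (e ∷ m) (s≤s m≤k) → q e m m≤k }

  -- Without function extensionality, P has to be closed under pointwise equality.
  ∃-Fin→? : ∀ k {P : (Fin k → Fin N) → Set} → (∀ f g → (∀ i → f i ≡ g i) → P f → P g) →
    (∀ f → Dec (P f)) → Dec (Σ (Fin k → Fin N) P)
  ∃-Fin→? zero resp P? with P? (λ ())
  ... | yes p = yes (_ , p)
  ... | no ¬p = no λ (f , p) → ¬p (resp f _ (λ ()) p)
  ∃-Fin→? (suc k) {P} resp P? with any? (λ x →
    ∃-Fin→? k {λ g → P (x ∷ᶠ g)}
      (λ g g′ g≗g′ → resp _ _ λ { fzero → refl ; (fsuc i) → g≗g′ i }) (λ g → P? (x ∷ᶠ g)))
  ... | yes (x , g , p) = yes (_ , p)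
  ... | no ¬q = no λ (f , p) →
    ¬q (f fzero , (λ i → f (fsuc i)) , resp f _ (λ { fzero → refl ; (fsuc i) → refl }) p)

  isEdge? : (e : Edge N) → Dec (IsEdge e)
  isEdge? (i , j) = toℕ i <? toℕ j

  validMove? : (k : ℕ) (s : State N) (m : List (Edge N)) → Dec (ValidMove k s m)
  validMove? k s m = allPairs? (λ x y → ¬? (x ≟ₑ y)) m
    ×-dec All.all? (λ e → isEdge? e ×-dec (s e ≟ᶜ uncol)) m
    ×-dec ((length m ≟ k) ⊎-dec ((length m <? k) ×-dec
             ∀-Edge? (λ e → isEdge? e →-dec (s e ≟ᶜ uncol) →-dec (_∈?_ _≟ₑ_ e m))))

  someUncoloured? : (s : State N) → Dec (SomeUncoloured s)
  someUncoloured? s = ∃-Edge? (λ e → isEdge? e ×-dec (s e ≟ᶜ uncol))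

  hasCopy? : ∀ {k} (G : Graph k) (c : Colour) (s : State N) → Dec (HasCopy G c s)
  hasCopy? {k} G c s = ∃-Fin→? k resp copy?
    where
    IsCopy : (Fin k → Fin N) → Set
    IsCopy f = Injective _≡_ _≡_ f × (∀ a b → adj G a b ≡ true → s (norm (f a) (f b)) ≡ c)
    resp : ∀ f g → (∀ i → f i ≡ g i) → IsCopy f → IsCopy g
    resp f g f≗g (inj , edges) =
      (λ {x} {y} e → inj (trans (f≗g x) (trans e (sym (f≗g y))))) ,
      λ a b ab → subst (λ z → s z ≡ c) (cong₂ norm (f≗g a) (f≗g b)) (edges a b ab)
    copy? : ∀ f → Dec (IsCopy f)
    copy? f =
      map′ (λ h {x} {y} → h x y) (λ h x y → h {x} {y})
           (all? λ x → all? λ y → (f x ≟ᶠ f y) →-dec (x ≟ᶠ y))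
      ×-dec all? λ a → all? λ b → (adj G a b Bool.≟ true) →-dec (s (norm (f a) (f b)) ≟ᶜ c)

  Playable : State N → List (Edge N) → Set
  Playable s m = Unique m × All (λ e → IsEdge e × s e ≡ uncol) m

  extendToValidMove : (k : ℕ) (s : State N) {m : List (Edge N)} → length m ≤ k →
    Playable s m → Σ (List (Edge N)) λ m* → ValidMove k s m* × m ⊆ m*
  extendToValidMove k s {m} m≤k = go (k ∸ length m) (m∸n+n≡m m≤k)
    where
    go : ∀ d {m} → d + length m ≡ k → Playable s m → Σ (List (Edge N)) λ m* → ValidMove k s m* × m ⊆ m*
    go zero    {m} eq (u , ok) = m , (u , ok , inj₁ eq) , λ e∈m → e∈m
    go (suc d) {m} eq (u , ok)
      with ∃-Edge? (λ e → (isEdge? e ×-dec (s e ≟ᶜ uncol)) ×-dec ¬? (_∈?_ _≟ₑ_ e m))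
    ... | yes (e , e-ok , e∉m) =
      let m* , valid , e∷m⊆m* = go d (trans (+-suc d (length m)) eq) (∉⇒Unique-∷ e∉m u , e-ok ∷ ok)
      in m* , valid , λ e∈m → e∷m⊆m* (there e∈m)
    ... | no ∄e = m , (u , ok , inj₂ (m<k , all∈m)) , λ e∈m → e∈m
      where
      m<k : length m < k
      m<k = subst (length m <_) eq (s≤s (m≤n+m (length m) d))
      all∈m : ∀ e → IsEdge e → s e ≡ uncol → e ∈ m
      all∈m e e-edge e-uncol with _∈?_ _≟ₑ_ e m
      ... | yes e∈m = e∈m
      ... | no e∉m  = ⊥-elim (∄e (e , (e-edge , e-uncol) , e∉m))

  someValidMove : (k : ℕ) (s : State N) → Σ (List (Edge N)) (ValidMove k s)
  someValidMove k s = let m , valid , _ = extendToValidMove k s z≤n ([] , []) in m , valid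

  ValidMove⇒length≤ : ∀ {k} {s : State N} {m} → ValidMove k s m → length m ≤ k
  ValidMove⇒length≤ (_ , _ , inj₁ m≡k)      = ≤-reflexive m≡k
  ValidMove⇒length≤ (_ , _ , inj₂ (m<k , _)) = <⇒≤ m<k

  ValidMove⇒colours-uncoloured : ∀ {k} {s : State N} {m} → 1 ≤ k → SomeUncoloured s → ValidMove k s m →
    Σ (Edge N) λ e → e ∈ m × s e ≡ uncol
  ValidMove⇒colours-uncoloured {m = []} 1≤k _ (_ , _ , inj₁ 0≡k) =
    ⊥-elim (1+n≰n (subst (1 ≤_) (sym 0≡k) 1≤k))
  ValidMove⇒colours-uncoloured {m = []} _ (e , e-edge , e-uncol) (_ , _ , inj₂ (_ , all∈m))
    with () ← all∈m e e-edge e-uncol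
  ValidMove⇒colours-uncoloured {m = e ∷ _} _ _ (_ , (_ , e-uncol) ∷ _ , _) = e , here refl , e-uncol

∑ : ∀ {k} → (Fin k → ℕ) → ℕ
∑ {zero}  f = 0
∑ {suc k} f = f fzero + ∑ (λ i → f (fsuc i))

∑-mono-≤ : ∀ {k} (f g : Fin k → ℕ) → (∀ i → f i ≤ g i) → ∑ f ≤ ∑ g
∑-mono-≤ {zero}  f g f≤g = z≤n
∑-mono-≤ {suc k} f g f≤g = +-mono-≤ (f≤g fzero) (∑-mono-≤ _ _ (λ i → f≤g (fsuc i)))

∑-mono-< : ∀ {k} (f g : Fin k → ℕ) → (∀ i → f i ≤ g i) → ∀ i₀ → f i₀ < g i₀ → ∑ f < ∑ g
∑-mono-< {suc k} f g f≤g fzero    lt = +-mono-<-≤ lt (∑-mono-≤ _ _ (λ i → f≤g (fsuc i)))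
∑-mono-< {suc k} f g f≤g (fsuc i₀) lt =
  +-mono-≤-< (f≤g fzero) (∑-mono-< _ _ (λ i → f≤g (fsuc i)) i₀ lt)

isUncoloured : Colour → ℕ
isUncoloured uncol = 1
isUncoloured blue  = 0
isUncoloured red   = 0

#uncoloured : ∀ {N} → State N → ℕ
#uncoloured s = ∑ λ i → ∑ λ j → isUncoloured (s (i , j))

#uncoloured-mono-< : ∀ {N} (s s′ : State N) → (∀ e → isUncoloured (s′ e) ≤ isUncoloured (s e)) →
  ∀ e₀ → isUncoloured (s′ e₀) < isUncoloured (s e₀) → #uncoloured s′ < #uncoloured s
#uncoloured-mono-< s s′ s′≤s (i₀ , j₀) lt =
  ∑-mono-< _ _ (λ i → ∑-mono-≤ _ _ (λ j → s′≤s (i , j))) i₀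
    (∑-mono-< _ _ (λ j → s′≤s (i₀ , j)) j₀ lt)

paint-isUncoloured-≤ : ∀ {N} c (m : List (Edge N)) s e → c ≢ uncol →
  isUncoloured (paint c m s e) ≤ isUncoloured (s e)
paint-isUncoloured-≤ c m s e c≢uncol with _∈?_ _≟ₑ_ e m | c
... | no _  | _     = ≤-refl
... | yes _ | uncol = ⊥-elim (c≢uncol refl)
... | yes _ | blue  = z≤n
... | yes _ | red   = z≤n

module _ {k : ℕ} (G : Graph k) (p q N : ℕ) (1≤p : 1 ≤ p) where

  round-decreases-#uncoloured : ∀ {s : State N} {m} m′ → SomeUncoloured s → ValidMove p s m →
    #uncoloured (paint red m′ (paint blue m s)) < #uncoloured s
  round-decreases-#uncoloured {s} {m} m′ some valid =
    let e , e∈m , e-uncol = ValidMove⇒colours-uncoloured {s = s} 1≤p some valid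
    in #uncoloured-mono-< s s₂ paint-≤ e (begin-strict
      isUncoloured (s₂ e) ≤⟨ paint-isUncoloured-≤ red m′ s₁ e (λ ()) ⟩
      isUncoloured (s₁ e) ≡⟨ cong isUncoloured (paint-∈ {s = s} e∈m) ⟩
      0                   <⟨ s≤s z≤n ⟩
      1                   ≡⟨ cong isUncoloured e-uncol ⟨
      isUncoloured (s e)  ∎)
    where
    open ≤-Reasoning
    s₁ = paint blue m s
    s₂ = paint red m′ s₁
    paint-≤ : ∀ e → isUncoloured (s₂ e) ≤ isUncoloured (s e)
    paint-≤ e = ≤-trans (paint-isUncoloured-≤ red m′ s₁ e (λ ())) (paint-isUncoloured-≤ blue m s e (λ ()))

  -- Every round colours an edge, so the uncoloured edges bound the depth of the game tree.
  aliceWins? : (s : State N) → Dec (AliceWins G p q N s)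
  aliceWins? s = go (suc (#uncoloured s)) s ≤-refl
    where
    go : (b : ℕ) (s : State N) → #uncoloured s < b → Dec (AliceWins G p q N s)
    go (suc b) s s<b with someUncoloured? s
    ... | no ¬some = no λ { (move some _ _ _) → ¬some some }
    ... | yes some = map′ from to (∃-List≤? p good?)
      where
      Good : List (Edge N) → Set
      Good m = ValidMove p s m × (HasCopy G blue (paint blue m s) ⊎
        (∀ m′ → length m′ ≤ q → ValidMove q (paint blue m s) m′ →
           (¬ HasCopy G red (paint red m′ (paint blue m s))) × AliceWins G p q N (paint red m′ (paint blue m s))))
      from : Σ (List (Edge N)) (λ m → length m ≤ p × Good m) → AliceWins G p q N s
      from (m , _ , valid , inj₁ copy) = move some m valid (inj₁ copy)
      from (m , _ , valid , inj₂ h)    = move some m valid (inj₂ λ m′ v → h m′ (ValidMove⇒length≤ v) v)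
      to : AliceWins G p q N s → Σ (List (Edge N)) (λ m → length m ≤ p × Good m)
      to (move _ m valid (inj₁ copy)) = m , ValidMove⇒length≤ valid , valid , inj₁ copy
      to (move _ m valid (inj₂ h))    = m , ValidMove⇒length≤ valid , valid , inj₂ λ m′ _ v → h m′ v
      good? : ∀ m → Dec (Good m)
      good? m with validMove? p s m
      ... | no ¬valid = no λ g → ¬valid (proj₁ g)
      ... | yes valid = map′ (valid ,_) proj₂ (hasCopy? G blue (paint blue m s) ⊎-dec
            ∀-List≤? q λ m′ → validMove? q (paint blue m s) m′ →-dec
              (¬? (hasCopy? G red (paint red m′ (paint blue m s)))
               ×-dec go b _ (<-≤-trans (round-decreases-#uncoloured m′ some valid) (≤-pred s<b))))

AliceWins⇒order≤ : ∀ {k} {G : Graph k} {p q N s} → AliceWins G p q N s → k ≤ N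
AliceWins⇒order≤ (move _ _ _ (inj₁ (_ , f-injective , _))) = injective⇒≤ f-injective
AliceWins⇒order≤ {q = q} (move _ m _ (inj₂ h)) =
  let m′ , valid = someValidMove q (paint blue m _) in AliceWins⇒order≤ (proj₂ (h m′ valid))

least-or-none : {W : ℕ → Set} → (∀ N → Dec (W N)) → ∀ m →
  (∀ N → N ≤ m → ¬ W N) ⊎ Σ ℕ (λ a → W a × a ≤ m × (∀ N → N < a → ¬ W N))
least-or-none W? zero with W? zero
... | yes w = inj₂ (zero , w , z≤n , λ _ ())
... | no ¬w = inj₁ λ { zero _ → ¬w }
least-or-none W? (suc m) with least-or-none W? m
... | inj₂ (a , w , a≤m , below) = inj₂ (a , w , m≤n⇒m≤1+n a≤m , below)
... | inj₁ none with W? (suc m)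
...   | yes w = inj₂ (suc m , w , ≤-refl , λ N N<1+m → none N (≤-pred N<1+m))
...   | no ¬w = inj₁ λ N N≤1+m → case m<1+n⇒m<n∨m≡n (s≤s N≤1+m) of λ
          { (inj₁ N<1+m) → none N (≤-pred N<1+m) ; (inj₂ refl) → ¬w }

leastWitness : {W : ℕ → Set} → (∀ N → Dec (W N)) → ∀ {m} → W m →
  Σ ℕ λ a → W a × a ≤ m × (∀ N → N < a → ¬ W N)
leastWitness W? {m} w with least-or-none W? m
... | inj₁ none  = ⊥-elim (none m ≤-refl w)
... | inj₂ least = least

-- Growth sequences of trees

lastOf-snoc : ∀ {A : Set} (x : A) rest v → lastOf x (rest ++ v ∷ []) ≡ v
lastOf-snoc x []         v = refl
lastOf-snoc x (y ∷ rest) v = lastOf-snoc y rest v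

Unique-snoc : ∀ {A : Set} {xs : List A} {v} → Unique xs → v ∉ xs → Unique (xs ++ v ∷ [])
Unique-snoc u v∉xs = Unique.++⁺ u ([] ∷ []) λ { (v∈xs , here refl) → v∉xs v∈xs }

module _ {n : ℕ} (T : Graph n) where

  IsPath-snoc : ∀ x rest v → IsPath T (x ∷ rest) → adj T (lastOf x rest) v ≡ true →
    IsPath T (x ∷ rest ++ v ∷ [])
  IsPath-snoc x []         v _          xv = xv , tt
  IsPath-snoc x (y ∷ rest) v (xy , path) yv = xy , IsPath-snoc y rest v path yv

  data Growth : List (Fin n) → List (Fin n × Fin n) → Set where
    done : ∀ {D} → Growth D []
    grow : ∀ {D u v steps} → u ∈ D → v ∉ D → adj T u v ≡ true →
           (∀ u′ → u′ ∈ D → adj T u′ v ≡ true → u′ ≡ u) →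
           Growth (v ∷ D) steps → Growth D ((u , v) ∷ steps)

  Covers : List (Fin n) → List (Fin n × Fin n) → Set
  Covers D steps = ∀ x → x ∈ D ⊎ x ∈ map proj₂ steps

  Covers⇒n≤length : ∀ {D steps} → Covers D steps → n ≤ length D + length steps
  Covers⇒n≤length {D} {steps} covers =
    subst (n ≤_) (trans (length-++ D) (cong (length D +_) (length-map proj₂ steps)))
      (covering⇒N≤length (D ++ map proj₂ steps) λ x → case covers x of λ
        { (inj₁ x∈D) → ∈-++⁺ˡ x∈D ; (inj₂ x∈steps) → ∈-++⁺ʳ D x∈steps })

  PathConnectedWithin : List (Fin n) → Set
  PathConnectedWithin D = ∀ x y → x ∈ D → y ∈ D → Σ (List (Fin n)) λ rest →
    lastOf x rest ≡ y × IsPath T (x ∷ rest) × Unique (x ∷ rest) × All (_∈ D) (x ∷ rest)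

  PathConnectedWithin-∷ : ∀ {D u v} → PathConnectedWithin D → u ∈ D → v ∉ D → adj T u v ≡ true →
    PathConnectedWithin (v ∷ D)
  PathConnectedWithin-∷ _ _ _ _ x y (here refl) (here refl) = [] , refl , tt , [] ∷ [] , here refl ∷ []
  PathConnectedWithin-∷ {D} {u} {v} paths u∈D v∉D uv x y (here refl) (there y∈D) =
    let rest , last , path , u-unique , inD = paths u y u∈D y∈D
    in u ∷ rest , last , (trans (adj-sym T v u) uv , path) ,
       All.¬Any⇒All¬ _ (λ v∈ → v∉D (All.lookup inD v∈)) ∷ u-unique , here refl ∷ All.map there inD
  PathConnectedWithin-∷ {D} {u} {v} paths u∈D v∉D uv x y (there x∈D) (here refl) =
    let rest , last , path , x-unique , inD = paths x u x∈D u∈D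
    in rest ++ v ∷ [] , lastOf-snoc x rest v ,
       IsPath-snoc x rest v path (subst (λ z → adj T z v ≡ true) (sym last) uv) ,
       Unique-snoc {xs = x ∷ rest} x-unique (λ v∈ → v∉D (All.lookup inD v∈)) ,
       All.++⁺ {xs = x ∷ rest} (All.map there inD) (here refl ∷ [])
  PathConnectedWithin-∷ paths _ _ _ x y (there x∈D) (there y∈D) =
    let rest , last , path , x-unique , inD = paths x y x∈D y∈D
    in rest , last , path , x-unique , All.map there inD

  module _ (connected : Connected T) (acyclic : ¬ HasCycle T) where

    -- Two neighbours of v in D, joined by a path in D, would close a cycle through v.
    unique-parent : ∀ {D u v} → PathConnectedWithin D → u ∈ D → v ∉ D → adj T u v ≡ true →
      ∀ u′ → u′ ∈ D → adj T u′ v ≡ true → u′ ≡ u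
    unique-parent {D} {u} {v} paths u∈D v∉D uv u′ u′∈D u′v with u′ ≟ᶠ u
    ... | yes u′≡u = u′≡u
    ... | no u′≢u with paths u u′ u∈D u′∈D
    ...   | [] , last , _ = ⊥-elim (u′≢u (sym last))
    ...   | y ∷ rest , last , path , u-unique , inD = ⊥-elim (acyclic
            (v , u ∷ y ∷ rest , All.¬Any⇒All¬ _ (λ v∈ → v∉D (All.lookup inD v∈)) ∷ u-unique ,
             s≤s (s≤s z≤n) , (trans (adj-sym T v u) uv , path) ,
             subst (λ z → adj T z v ≡ true) (sym last) u′v))

    Frontier : List (Fin n) → Set
    Frontier D = Σ (Fin n) λ v → v ∉ D × Σ (Fin n) λ u → u ∈ D × adj T u v ≡ true

    frontier? : ∀ D → Dec (Frontier D)
    frontier? D = any? λ v → ¬? (_∈?_ _≟ᶠ_ v D) ×-dec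
                  any? λ u → _∈?_ _≟ᶠ_ u D ×-dec (adj T u v Bool.≟ true)

    ¬Frontier⇒∈ : ∀ {D w x} → ¬ Frontier D → Walk T w x → w ∈ D → x ∈ D
    ¬Frontier⇒∈ closed here w∈D = w∈D
    ¬Frontier⇒∈ {D} closed (step {w = w′} ww′ walk) w∈D with _∈?_ _≟ᶠ_ w′ D
    ... | yes w′∈D = ¬Frontier⇒∈ closed walk w′∈D
    ... | no w′∉D  = ⊥-elim (closed (w′ , w′∉D , _ , w∈D , ww′))

    growthSequence : (r : Fin n) →
      Σ (List (Fin n × Fin n)) λ steps → Growth (r ∷ []) steps × Covers (r ∷ []) steps
    growthSequence r = grow-from n (n≤1+n n) ([] ∷ []) paths₀ (here refl)
      where
      paths₀ : PathConnectedWithin (r ∷ [])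
      paths₀ x y (here refl) (here refl) = [] , refl , tt , [] ∷ [] , here refl ∷ []
      grow-from : ∀ fuel {D} → n ≤ length D + fuel → Unique D → PathConnectedWithin D → r ∈ D →
        Σ (List (Fin n × Fin n)) λ steps → Growth D steps × Covers D steps
      grow-from fuel {D} n≤ D-unique paths r∈D with frontier? D
      ... | no closed = [] , done , λ x → inj₁ (¬Frontier⇒∈ closed (connected r x) r∈D)
      ... | yes (v , v∉D , u , u∈D , uv) with fuel
      ...   | zero =
        ⊥-elim (<⇒≱ (∉∧Unique⇒length<N v∉D D-unique) (subst (n ≤_) (+-identityʳ (length D)) n≤))
      ...   | suc fuel′ =
        let steps , growth , covers = grow-from fuel′ (subst (n ≤_) (+-suc (length D) fuel′) n≤)
              (∉⇒Unique-∷ v∉D D-unique) (PathConnectedWithin-∷ paths u∈D v∉D uv) (there r∈D)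
        in (u , v) ∷ steps , grow u∈D v∉D uv (unique-parent paths u∈D v∉D uv) growth ,
           λ x → case covers x of λ
             { (inj₁ (here x≡v))  → inj₂ (here x≡v)
             ; (inj₁ (there x∈D)) → inj₁ x∈D
             ; (inj₂ x∈steps)     → inj₂ (there x∈steps) }

  Growth⇒fresh : ∀ {D steps} → Growth D steps → All (λ (_ , v) → v ∉ D) steps
  Growth⇒fresh done = []
  Growth⇒fresh (grow _ v∉D _ _ growth) =
    v∉D ∷ All.map (λ v∉ v∈D → v∉ (there v∈D)) (Growth⇒fresh growth)

  Growth⇒adjacent : ∀ {D steps} → Growth D steps → All (λ (u , v) → adj T u v ≡ true) steps
  Growth⇒adjacent done = []
  Growth⇒adjacent (grow _ _ uv _ growth) = uv ∷ Growth⇒adjacent growth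

  stepEdges : ∀ {N} → (Fin n → Fin N) → List (Fin n × Fin n) → List (Edge N)
  stepEdges f = map λ (u , v) → norm (f u) (f v)

  stepEdges-unique : ∀ {N D steps} (f : Fin n → Fin N) → Injective _≡_ _≡_ f → Growth D steps →
    Unique (stepEdges f steps)
  stepEdges-unique f f-injective done = []
  stepEdges-unique {D = D} f f-injective (grow {u = u} {v} u∈D v∉D _ _ growth) =
    All.map⁺ (All.map distinct (Growth⇒fresh growth)) ∷ stepEdges-unique f f-injective growth
    where
    distinct : ∀ {(u′ , v′) : Fin n × Fin n} → v′ ∉ v ∷ D → norm (f u) (f v) ≢ norm (f u′) (f v′)
    distinct {u′ , v′} v′∉ e with norm-injective _ _ _ _ e
    ... | inj₁ (_ , fv≡fv′) = v′∉ (here (sym (f-injective fv≡fv′)))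
    ... | inj₂ (fu≡fv′ , _) = v′∉ (there (subst (_∈ D) (f-injective fu≡fv′) u∈D))

-- Alice's strategy

module Strategy {n : ℕ} (T : Graph n) (p q N : ℕ) (q≤p : q ≤ p) (1≤p : 1 ≤ p)
  (room : ∀ r → r * p ≤ n ∸ 2 → n + q * r ≤ N)
  {root : Fin n} {treeSteps : List (Fin n × Fin n)}
  (treeGrowth : Growth T (root ∷ []) treeSteps) (treeCovers : Covers T (root ∷ []) treeSteps) where

  -- s is the position when Alice, in her (r+1)-st turn, has already chosen the edges m;
  -- φ embeds the vertices D grown so far, and R lists the edges of Bob's r moves.
  record Invariant (s : State N) (R : List (Edge N)) (r : ℕ) (D : List (Fin n))
                   (steps : List (Fin n × Fin n)) (φ : Fin n → Fin N) (m : List (Edge N)) : Set where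
    field
      growth      : Growth T D steps
      covers      : Covers T D steps
      D-unique    : Unique D
      φ-injective : ∀ a b → a ∈ D → b ∈ D → φ a ≡ φ b → a ≡ b
      tree-blue   : ∀ a b → a ∈ D → b ∈ D → adj T a b ≡ true →
                    norm (φ a) (φ b) ∈ m ⊎ s (norm (φ a) (φ b)) ≡ blue
      blue-within : ∀ e → s e ≡ blue → Within (map φ D) e
      m-playable  : Playable s m
      m-within    : All (Within (map φ D)) m
      red⊆R       : ∀ e → s e ≡ red → e ∈ R
      R≤qr        : length R ≤ q * r
      1+rp≤D      : 1 + r * p ≤ length D
  open Invariant

  -- A vertex w is unusable for v only if it lies in the image or the edge from φ u to w is red
  -- (blue edges stay inside the image); that excludes at most |D| + q r < N vertices.
  freshTarget : ∀ {s R r D u v steps φ m} → Invariant s R r D ((u , v) ∷ steps) φ m →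
    Σ (Fin N) λ w → w ∉ map φ D × s (norm (φ u) w) ≡ uncol
  freshTarget {s} {R} {r} {D} {u} {φ = φ} I with growth I
  ... | grow _ v∉D _ _ _ with any? (λ w → ¬? (_∈?_ _≟ᶠ_ w (map φ D)) ×-dec (s (norm (φ u) w) ≟ᶜ uncol))
  ...   | yes found = found
  ...   | no ∄w = ⊥-elim (<⇒≱ blocked<N (covering⇒N≤length blocked blocks-all))
    where
    blocked : List (Fin N)
    blocked = map φ D ++ map (opposite (φ u)) R
    blocks-all : ∀ w → w ∈ blocked
    blocks-all w with _∈?_ _≟ᶠ_ w (map φ D)
    ... | yes w∈image = ∈-++⁺ˡ w∈image
    ... | no w∉image with s (norm (φ u) w) in colour
    ...   | uncol = ⊥-elim (∄w (w , w∉image , colour))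
    ...   | blue  = ⊥-elim (w∉image (Within-norm⁻ (φ u) w (blue-within I _ colour)))
    ...   | red   = ∈-++⁺ʳ (map φ D) (subst (_∈ map (opposite (φ u)) R) (opposite-norm (φ u) w)
                      (∈-map⁺ (opposite (φ u)) (red⊆R I _ colour)))
    D<n : length D < n
    D<n = ∉∧Unique⇒length<N v∉D (D-unique I)
    blocked<N : length blocked < N
    blocked<N = begin-strict
      length blocked                                 ≡⟨ length-++ (map φ D) ⟩
      length (map φ D) + length (map (opposite (φ u)) R) ≡⟨ cong₂ _+_ (length-map φ D) (length-map _ R) ⟩
      length D + length R                            <⟨ +-mono-<-≤ D<n (R≤qr I) ⟩
      n + q * r                                      ≤⟨ room r (∸-monoˡ-≤ 2 (≤-trans (s≤s (1+rp≤D I)) D<n)) ⟩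
      N                                              ∎
      where open ≤-Reasoning

  Invariant⇒someUncoloured : ∀ {s R r D u v steps φ m} → Invariant s R r D ((u , v) ∷ steps) φ m →
    SomeUncoloured s
  Invariant⇒someUncoloured {u = u} {φ = φ} I with growth I | freshTarget I
  ... | grow u∈D _ _ _ _ | w , w∉image , uncoloured =
    norm (φ u) w ,
    norm-IsEdge (φ u) w (λ φu≡w → w∉image (subst (_∈ _) φu≡w (∈-map⁺ φ u∈D))) ,
    uncoloured

  embedNext : ∀ {s R r D u v steps φ m} → Invariant s R r D ((u , v) ∷ steps) φ m →
    Σ (Fin N) λ w → Invariant s R r (v ∷ D) steps (updateAt φ v (const w)) (norm (φ u) w ∷ m)
  embedNext {s} {R} {r} {D} {u} {v} {steps} {φ} {m} I with growth I | freshTarget I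
  ... | grow u∈D v∉D uv parent growth′ | w , w∉image , uw-uncoloured = w , record
    { growth      = growth′
    ; covers      = λ x → case covers I x of λ
                      { (inj₁ x∈D) → inj₁ (there x∈D)
                      ; (inj₂ (here x≡v)) → inj₁ (here x≡v)
                      ; (inj₂ (there x∈steps)) → inj₂ x∈steps }
    ; D-unique    = ∉⇒Unique-∷ v∉D (D-unique I)
    ; φ-injective = φ′-injective
    ; tree-blue   = tree-blue′
    ; blue-within = λ e e-blue → extend (blue-within I e e-blue)
    ; m-playable  = ∉⇒Unique-∷ uw∉m (proj₁ (m-playable I)) ,
                    (norm-IsEdge (φ u) w φu≢w , uw-uncoloured) ∷ proj₂ (m-playable I)
    ; m-within    = toImage′ (Within-norm⁺ (φ u) w (there φu∈image) (here refl)) ∷ All.map extend (m-within I)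
    ; red⊆R       = red⊆R I
    ; R≤qr        = R≤qr I
    ; 1+rp≤D      = ≤-trans (1+rp≤D I) (n≤1+n _)
    }
    where
    φ′ : Fin n → Fin N
    φ′ = updateAt φ v (const w)
    φ′-v : φ′ v ≡ w
    φ′-v = updateAt-updates v φ
    φ′-D : ∀ {a} → a ∈ D → φ′ a ≡ φ a
    φ′-D a∈D = updateAt-minimal _ v φ λ a≡v → v∉D (subst (_∈ D) a≡v a∈D)
    φ′-norm : ∀ {a b} → a ∈ D → b ∈ D → norm (φ′ a) (φ′ b) ≡ norm (φ a) (φ b)
    φ′-norm a∈D b∈D = cong₂ norm (φ′-D a∈D) (φ′-D b∈D)
    toImage′ : ∀ {e} → Within (w ∷ map φ D) e → Within (map φ′ (v ∷ D)) e
    toImage′ {e} = subst (λ L → Within L e) (sym (cong₂ _∷_ φ′-v (map-cong-local (All.tabulate φ′-D))))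
    extend : ∀ {e} → Within (map φ D) e → Within (map φ′ (v ∷ D)) e
    extend within = toImage′ (Within-∷ w within)
    φu∈image : φ u ∈ map φ D
    φu∈image = ∈-map⁺ φ u∈D
    φu≢w : φ u ≢ w
    φu≢w φu≡w = w∉image (subst (_∈ map φ D) φu≡w φu∈image)
    uw∉m : norm (φ u) w ∉ m
    uw∉m uw∈m = w∉image (Within-norm⁻ (φ u) w (All.lookup (m-within I) uw∈m))
    w≢φ′ : ∀ {b} → b ∈ D → w ≢ φ′ b
    w≢φ′ {b} b∈D w≡φ′b =
      w∉image (subst (_∈ map φ D) (sym (trans w≡φ′b (φ′-D b∈D))) (∈-map⁺ φ b∈D))
    φ′-injective : ∀ a b → a ∈ v ∷ D → b ∈ v ∷ D → φ′ a ≡ φ′ b → a ≡ b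
    φ′-injective a b (here a≡v)  (here b≡v)  _ = trans a≡v (sym b≡v)
    φ′-injective a b (here refl) (there b∈D) e = ⊥-elim (w≢φ′ b∈D (trans (sym φ′-v) e))
    φ′-injective a b (there a∈D) (here refl) e = ⊥-elim (w≢φ′ a∈D (trans (sym φ′-v) (sym e)))
    φ′-injective a b (there a∈D) (there b∈D) e =
      φ-injective I a b a∈D b∈D (trans (sym (φ′-D a∈D)) (trans e (φ′-D b∈D)))
    tree-blue′ : ∀ a b → a ∈ v ∷ D → b ∈ v ∷ D → adj T a b ≡ true →
      norm (φ′ a) (φ′ b) ∈ norm (φ u) w ∷ m ⊎ s (norm (φ′ a) (φ′ b)) ≡ blue
    tree-blue′ a b (here refl) (here refl) vv = case trans (sym vv) (irref T v) of λ ()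
    tree-blue′ a b (here refl) (there b∈D) vb = inj₁ (here (begin
      norm (φ′ v) (φ′ b) ≡⟨ cong₂ norm φ′-v (trans (φ′-D b∈D) (cong φ b≡u)) ⟩
      norm w (φ u)       ≡⟨ norm-comm w (φ u) (λ w≡φu → φu≢w (sym w≡φu)) ⟩
      norm (φ u) w       ∎))
      where
      open ≡-Reasoning
      b≡u : b ≡ u
      b≡u = parent b b∈D (trans (adj-sym T b v) vb)
    tree-blue′ a b (there a∈D) (here refl) av =
      inj₁ (here (cong₂ norm (trans (φ′-D a∈D) (cong φ (parent a a∈D av))) φ′-v))
    tree-blue′ a b (there a∈D) (there b∈D) ab with tree-blue I a b a∈D b∈D ab
    ... | inj₁ ab∈m    = inj₁ (there (subst (_∈ m) (sym (φ′-norm a∈D b∈D)) ab∈m))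
    ... | inj₂ ab-blue = inj₂ (subst (λ e → s e ≡ blue) (sym (φ′-norm a∈D b∈D)) ab-blue)

  embedMany : ∀ j {s R r D steps φ m} → j ≤ length steps → Invariant s R r D steps φ m →
    Σ (List (Fin n)) λ D′ → Σ (List (Fin n × Fin n)) λ steps′ →
    Σ (Fin n → Fin N) λ φ′ → Σ (List (Edge N)) λ m′ →
      Invariant s R r D′ steps′ φ′ m′ ×
      length D′ ≡ j + length D × length m′ ≡ j + length m × length steps ≡ j + length steps′
  embedMany zero {D = D} {steps} {φ} {m} _ I = D , steps , φ , m , I , refl , refl , refl
  embedMany (suc j) {steps = _ ∷ _} (s≤s j≤) I =
    let _ , I′ = embedNext I
        D′ , steps′ , φ′ , m′ , I″ , len-D , len-m , len-steps = embedMany j j≤ I′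
    in D′ , steps′ , φ′ , m′ , I″ , trans len-D (+-suc j _) , trans len-m (+-suc j _) , cong suc len-steps

  embedAll : ∀ {s R r D steps φ m} → Invariant s R r D steps φ m →
    Σ (List (Fin n)) λ D′ → Σ (Fin n → Fin N) λ φ′ → Σ (List (Edge N)) λ m′ →
      Invariant s R r D′ [] φ′ m′ × length m′ ≡ length steps + length m
  embedAll {steps = []} I = _ , _ , _ , I , refl
  embedAll {steps = _ ∷ steps} {m = m} I =
    let _ , I′ = embedNext I
        D′ , φ′ , m′ , I″ , len-m = embedAll I′
    in D′ , φ′ , m′ , I″ , trans len-m (+-suc (length steps) (length m))

  Invariant⇒blueCopy : ∀ {s R r D φ m m*} → Invariant s R r D [] φ m → m ⊆ m* →
    HasCopy T blue (paint blue m* s)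
  Invariant⇒blueCopy {s} {φ = φ} {m* = m*} I m⊆m* =
    φ , (λ {a} {b} → φ-injective I a b (∈D a) (∈D b)) ,
    λ a b ab → case tree-blue I a b (∈D a) (∈D b) ab of λ
      { (inj₁ ab∈m)    → paint-∈ {m = m*} {s} (m⊆m* ab∈m)
      ; (inj₂ ab-blue) → paint-idem {m = m*} {s} ab-blue }
    where
    ∈D : ∀ x → x ∈ _
    ∈D x = case covers I x of λ { (inj₁ x∈D) → x∈D ; (inj₂ ()) }

  Invariant⇒¬redCopy : ∀ {s R r D u v steps φ m} → Invariant s R r D ((u , v) ∷ steps) φ m →
    ¬ HasCopy T red s
  Invariant⇒¬redCopy {s} {R} {r} {D} I (f , f-injective , red-edges) with growth I
  ... | grow _ v∉D _ _ _ = <⇒≱ (∉∧Unique⇒length<N v∉D (D-unique I)) (begin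
    n                                   ≤⟨ Covers⇒n≤length T treeCovers ⟩
    1 + length treeSteps                ≡⟨ cong suc (length-map _ treeSteps) ⟨
    1 + length (stepEdges T f treeSteps) ≤⟨ s≤s (Unique∧⊆⇒length≤ edges-unique edges-red) ⟩
    1 + length R                        ≤⟨ s≤s (R≤qr I) ⟩
    1 + q * r                           ≤⟨ s≤s (*-monoˡ-≤ r q≤p) ⟩
    1 + p * r                           ≡⟨ cong suc (*-comm p r) ⟩
    1 + r * p                           ≤⟨ 1+rp≤D I ⟩
    length D                            ∎)
    where
    open ≤-Reasoning
    edges-unique : Unique (stepEdges T f treeSteps)
    edges-unique = stepEdges-unique T f f-injective treeGrowth
    edges-red : stepEdges T f treeSteps ⊆ R
    edges-red e∈ with ∈-map⁻ _ e∈
    ... | (a , b) , ab∈steps , refl =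
      red⊆R I _ (red-edges a b (All.lookup (Growth⇒adjacent T treeGrowth) ab∈steps))

  bobReplies : ∀ {s R r D steps φ m m′} → Invariant s R r D steps φ m → 1 + suc r * p ≤ length D →
    ValidMove q (paint blue m s) m′ → Invariant (paint red m′ (paint blue m s)) (m′ ++ R) (suc r) D steps φ []
  bobReplies {s} {R} {r} {D} {steps} {φ} {m} {m′} I 1+rp≤D′ valid@(_ , m′-uncoloured , _) = record
    { growth      = growth I
    ; covers      = covers I
    ; D-unique    = D-unique I
    ; φ-injective = φ-injective I
    ; tree-blue   = λ a b a∈D b∈D ab → inj₂ (stays-blue (case tree-blue I a b a∈D b∈D ab of λ
                      { (inj₁ ab∈m)    → paint-∈ {m = m} {s} ab∈m
                      ; (inj₂ ab-blue) → paint-idem {m = m} {s} ab-blue }))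
    ; blue-within = blue-within′
    ; m-playable  = [] , []
    ; m-within    = []
    ; red⊆R       = red⊆R′
    ; R≤qr        = begin
        length (m′ ++ R)      ≡⟨ length-++ m′ ⟩
        length m′ + length R  ≤⟨ +-mono-≤ (ValidMove⇒length≤ valid) (R≤qr I) ⟩
        q + q * r             ≡⟨ *-suc q r ⟨
        q * suc r             ∎
    ; 1+rp≤D      = 1+rp≤D′
    }
    where
    open ≤-Reasoning
    s₁ = paint blue m s
    s₂ = paint red m′ s₁
    stays-blue : ∀ {e} → s₁ e ≡ blue → s₂ e ≡ blue
    stays-blue e-blue =
      trans (paint-coloured {m = m′} {s₁} m′-uncoloured λ e-uncol → case trans (sym e-blue) e-uncol of λ ()) e-blue
    blue-within′ : ∀ e → s₂ e ≡ blue → Within (map φ D) e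
    blue-within′ e e-blue with _∈?_ _≟ₑ_ e m′ | _∈?_ _≟ₑ_ e m
    ... | yes _   | _       = case e-blue of λ ()
    ... | no _    | yes e∈m = All.lookup (m-within I) e∈m
    ... | no _    | no e∉m  = blue-within I e e-blue
    red⊆R′ : ∀ e → s₂ e ≡ red → e ∈ m′ ++ R
    red⊆R′ e e-red with _∈?_ _≟ₑ_ e m′ | _∈?_ _≟ₑ_ e m
    ... | yes e∈m′ | _      = ∈-++⁺ˡ e∈m′
    ... | no _     | yes _  = case e-red of λ ()
    ... | no _     | no _   = ∈-++⁺ʳ m′ (red⊆R I e e-red)

  finalRound : ∀ {s R r D u v steps φ} → suc (length steps) ≤ p →
    Invariant s R r D ((u , v) ∷ steps) φ [] → AliceWins T p q N s
  finalRound {s} fits I =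
    let _ , _ , m , I′ , len-m = embedAll I
        m* , valid , m⊆m* = extendToValidMove p s (subst (_≤ p) (sym (trans len-m (+-identityʳ _))) fits)
                              (m-playable I′)
    in move (Invariant⇒someUncoloured I) m* valid (inj₁ (Invariant⇒blueCopy I′ m⊆m*))

  strategy : ∀ fuel {s R r D u v steps φ} → length steps < fuel →
    Invariant s R r D ((u , v) ∷ steps) φ [] → AliceWins T p q N s
  strategy fuel {steps = steps} _ I with suc (length steps) ≤? p
  ... | yes fits = finalRound fits I
  strategy (suc fuel) {s} {R} {r} {D} {steps = steps} steps≤fuel I | no ¬fits
    with embedMany p (<⇒≤ (≰⇒> ¬fits)) I
  ... | _ , [] , _ , _ , _ , _ , _ , len-steps = ⊥-elim (¬fits (≤-reflexive (trans len-steps (+-identityʳ p))))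
  ... | D′ , (_ , _) ∷ steps′ , φ′ , m , I′ , len-D′ , len-m , len-steps =
    move (Invariant⇒someUncoloured I) m valid (inj₂ λ m′ bob →
      let I″ = bobReplies I′ 1+rp≤D′ bob in Invariant⇒¬redCopy I″ , strategy fuel steps′<fuel I″)
    where
    valid : ValidMove p s m
    valid = proj₁ (m-playable I′) , proj₂ (m-playable I′) , inj₁ (trans len-m (+-identityʳ p))
    1+rp≤D′ : 1 + suc r * p ≤ length D′
    1+rp≤D′ = subst (1 + suc r * p ≤_) (sym len-D′)
      (subst (_≤ p + length D) (+-suc p (r * p)) (+-monoʳ-≤ p (1+rp≤D I)))
    steps′<fuel : length steps′ < fuel
    steps′<fuel = ≤-trans (≤-pred (begin
      suc (suc (length steps′))  ≤⟨ +-monoˡ-≤ (suc (length steps′)) 1≤p ⟩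
      p + suc (length steps′)    ≡⟨ len-steps ⟨
      suc (length steps)         ∎)) (≤-pred steps≤fuel)
      where open ≤-Reasoning

  aliceWins : 2 ≤ n → Fin N → AliceWinsOn p q T N
  aliceWins 2≤n z = start treeGrowth treeCovers
    where
    start : ∀ {steps} → Growth T (root ∷ []) steps → Covers T (root ∷ []) steps → AliceWinsOn p q T N
    start {[]} _ covers = ⊥-elim (<⇒≱ 2≤n (Covers⇒n≤length T covers))
    start {(u , v) ∷ steps} growth₀ covers₀ =
      strategy (suc (length steps)) {initial N} {[]} {0} {root ∷ []} {φ = const z} ≤-refl record
        { growth      = growth₀
        ; covers      = covers₀
        ; D-unique    = [] ∷ []
        ; φ-injective = λ { a b (here refl) (here refl) _ → refl }
        ; tree-blue   = λ { a b (here refl) (here refl) rr → case trans (sym rr) (irref T root) of λ () }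
        ; blue-within = λ _ ()
        ; m-playable  = [] , []
        ; m-within    = []
        ; red⊆R       = λ _ ()
        ; R≤qr        = z≤n
        ; 1+rp≤D      = ≤-refl
        }

theorem1 : (p q : ℕ) → (q≥1 : 1 ≤ q) → (p≥q : q ≤ p) →
    (n : ℕ) → 2 ≤ n → (T : Graph n) → IsTree T →
    Σ ℕ (λ a → IsAchievementNumber p q T a × n ≤ a
      × a ≤ n + q * _/_ (n ∸ 2) p {{>-nonZero (≤-trans q≥1 p≥q)}})
theorem1 p q q≥1 p≥q n@(suc (suc _)) 2≤n@(s≤s (s≤s z≤n)) T (connected , acyclic) =
  let a , wins-a , a≤N₀ , below-a = leastWitness (λ N → aliceWins? T p q N 1≤p (initial N)) wins-N₀
  in a , (wins-a , below-a) , AliceWins⇒order≤ wins-a , a≤N₀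
  where
  1≤p : 1 ≤ p
  1≤p = ≤-trans q≥1 p≥q
  instance
    p-nonZero : NonZero p
    p-nonZero = >-nonZero 1≤p
  N₀ : ℕ
  N₀ = n + q * ((n ∸ 2) / p)
  room : ∀ r → r * p ≤ n ∸ 2 → n + q * r ≤ N₀
  room r rp≤ = +-monoʳ-≤ n (*-monoʳ-≤ q (m*n≤o⇒m≤o/n p rp≤))
  wins-N₀ : AliceWinsOn p q T N₀
  wins-N₀ = let _ , growth , covers = growthSequence T connected acyclic fzero
            in Strategy.aliceWins T p q N₀ p≥q 1≤p room growth covers 2≤n fzero
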